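{- Let $n=p_1^{\alpha_1}p_2^{\alpha_2}\cdots p_r^{\alpha_r}$, where $r\geq 2$, $\alpha_1,\ldots,\alpha_r$ are positive integers and $p_1<p_2<\cdots<p_r$ are prime numbers. Suppose that at least one of the following holds: (i) $p_1\geq r+1$ and $p_r>r\,p_{r-1}$; (ii) $p_{i+1}>r\,p_i$ for each $i\in\{1,2,\ldots,r-1\}$. Then $\delta(\mathcal{P}(C_n))=\deg(p_r^{\alpha_r})$.
   Context: For a finite group $G$, the power graph $\mathcal{P}(G)$ is the simple undirected graph with vertex set $G$ in which two distinct vertices are adjacent if one of them is an integral power of the other. $C_n$ denotes the cyclic group of order $n$, identified with $\mathbb{Z}_n=\{0,1,\ldots,n-1\}$; a positive divisor $d$ of $n$ is regarded as the vertex $d \bmod n$. $\deg(a)$ denotes the degree of vertex $a$ in $\mathcal{P}(C_n)$ and $\delta(\mathcal{P}(C_n))$ the minimum degree. -}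

module Defs where

open import Data.Nat using (ℕ; zero; suc; _*_; _^_; _⊓_; _%_)
open import Data.Nat.Properties using (_≟_)
open import Data.Fin using (Fin; zero; suc)
open import Data.List using (List; upTo; filter; length; foldr)
open import Data.List.Relation.Unary.Any using (any?)
open import Data.Product using (_×_)
open import Data.Sum using (_⊎_)
open import Relation.Nullary using (Dec; ¬?)
open import Relation.Nullary.Decidable using (_×-dec_; _⊎-dec_)

∏ : ∀ {k} → (Fin k → ℕ) → ℕ
∏ {zero}  f = 1
∏ {suc k} f = f zero * ∏ (λ i → f (suc i))

-- reduction modulo n (the n = 0 case is irrelevant for us)
modN : ℕ → ℕ → ℕ
modN x zero    = x
modN x (suc m) = x % suc m

-- In C_n ≅ ℤ_n = {0,…,n-1} (additive), the integral powers of a are the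
-- multiples k·a mod n; since n·a = 0 it suffices to take k ∈ {0,…,n-1}.
-- IsPow? n a b : b is an integral power of a in ℤ_n.
IsPow? : (n a b : ℕ) → Dec _
IsPow? n a b = any? (λ k → modN (k * a) n ≟ b) (upTo n)

Adj? : (n a b : ℕ) → Dec _
Adj? n a b = ¬? (a ≟ b) ×-dec (IsPow? n a b ⊎-dec IsPow? n b a)

deg : ℕ → ℕ → ℕ
deg n a = length (filter (Adj? n a) (upTo n))

-- minimum degree δ(P(C_n)) = min over a ∈ {0,…,n-1} of deg n a  (meaningful for n ≥ 1)
δ : ℕ → ℕ
δ n = foldr (λ a m → deg n a ⊓ m) (deg n 0) (upTo n)

module Submission where

-- Write n = M·v with v = p_r^α_r.  For a ∈ ℤ_n with g = gcd(a, n), a vertex b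
-- is adjacent or equal to a iff g ∣ b or gcd(b, n) ∣ g, so deg(a) + 1 is the
-- size of a "closed neighbourhood" that depends only on g; for g = v it is
-- M + (v − 1)·φ(M).  If g is coprime to M, then g divides the prime power v
-- and the neighbourhood of v lies inside that of g.  Otherwise some p_i ∣ g,
-- and every b with gcd(b, M) ∣ p_i and p_r ∤ b is a neighbour of g; counting
-- these and using φ(M) ≥ M/r and r·p_i < p_r (both consequences of either
-- hypothesis) gives deg(v) ≤ deg(a).

open import Defs
open import Data.Nat using (ℕ; _≤_; _<_; _+_; _*_; _^_)
open import Data.Nat.Primality using (Prime)
open import Data.Fin using (Fin; zero; suc; fromℕ; inject₁) renaming (_<_ to _<ᶠ_)
open import Data.Product using (_×_)
open import Data.Sum using (_⊎_)
open import Relation.Binary.PropositionalEquality using (_≡_)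

open import Data.Nat using (zero; suc; _∸_; _%_; _⊓_; z≤n; s≤s; NonZero; >-nonZero; nonTrivial⇒n>1)
open import Data.Nat.Properties
open import Data.Nat.Divisibility
open import Data.Nat.DivMod using ([m+kn]%n≡m%n; %-distribˡ-*; m%n%n≡m%n; m<n⇒m%n≡m; m%n<n)
open import Data.Nat.GCD using (gcd; gcd[m,n]∣m; gcd[m,n]∣n; gcd-greatest; gcd-GCD; c*gcd[m,n]≡gcd[cm,cn]; module Bézout)
open import Data.Nat.Coprimality using (Coprime; coprime?; coprime-divisor; coprime-+; coprime⇒gcd≡1) renaming (sym to ⊥-sym)
open import Data.Nat.Primality using (prime; prime⇒irreducible; prime⇒nonZero)
open import Data.Nat.Tactic.RingSolver using (solve-∀)
open import Data.Fin using (toℕ)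
open import Data.Fin.Properties using (toℕ-inject₁; toℕ-fromℕ; toℕ<n; toℕ-injective)
import Data.Fin.Properties as Fin
open import Data.List using (List; []; _∷_; upTo; filter; length; foldr; _++_; [_])
open import Data.List.Properties using (upTo-∷ʳ; filter-++; length-++)
open import Data.List.Relation.Unary.Any using (Any; here; there; satisfied)
open import Data.List.Membership.Propositional using (_∈_; lose)
open import Data.List.Membership.Propositional.Properties using (∈-upTo⁺; ∈-upTo⁻)
open import Data.Product using (_,_; ∃)
open import Data.Sum using (inj₁; inj₂)
open import Data.Empty using (⊥-elim)
open import Level using (0ℓ)
open import Relation.Nullary using (Dec; yes; no; ¬_; contradiction)
open import Relation.Nullary.Decidable using (_⊎-dec_)
open import Relation.Unary using (Pred; Decidable)
open import Relation.Unary.Properties using (_∪?_; _∩?_; ∁?; U?; ∅?)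
open import Relation.Binary.PropositionalEquality hiding ([_])
open import Algebra.Properties.CommutativeSemigroup +-commutativeSemigroup using (interchange)
open import Algebra.Properties.CommutativeSemigroup *-commutativeSemigroup using (xy∙z≈xz∙y)
open import Algebra.Properties.Semiring.Sum +-*-semiring using (sum; *-distribˡ-sum)

-- Qualified equational reasoning, for equality chains nested in ≤-chains.
module ≡ = ≡-Reasoning

indicator : {A : Set} → Dec A → ℕ
indicator (yes _) = 1
indicator (no _)  = 0

indicator-mono : {A B : Set} (a : Dec A) (b : Dec B) → (A → B) → indicator a ≤ indicator b
indicator-mono (yes _) (yes _) _   = ≤-refl
indicator-mono (yes x) (no ¬y) A⇒B = contradiction (A⇒B x) ¬y
indicator-mono (no _)  _       _   = z≤n

count : {P : Pred ℕ 0ℓ} → Decidable P → ℕ → ℕ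
count P? zero    = 0
count P? (suc n) = count P? n + indicator (P? n)

_⊆[_]_ : Pred ℕ 0ℓ → ℕ → Pred ℕ 0ℓ → Set
P ⊆[ n ] Q = ∀ {x} → x < n → P x → Q x

count-mono : {P Q : Pred ℕ 0ℓ} (P? : Decidable P) (Q? : Decidable Q) →
             ∀ n → P ⊆[ n ] Q → count P? n ≤ count Q? n
count-mono P? Q? zero    _    = z≤n
count-mono P? Q? (suc n) P⊆Q =
  +-mono-≤ (count-mono P? Q? n (λ x<n → P⊆Q (m<n⇒m<1+n x<n))) (indicator-mono (P? n) (Q? n) (P⊆Q ≤-refl))

count-cong : {P Q : Pred ℕ 0ℓ} (P? : Decidable P) (Q? : Decidable Q) →
             ∀ n → P ⊆[ n ] Q → Q ⊆[ n ] P → count P? n ≡ count Q? n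
count-cong P? Q? n P⊆Q Q⊆P = ≤-antisym (count-mono P? Q? n P⊆Q) (count-mono Q? P? n Q⊆P)

count-U : ∀ n → count U? n ≡ n
count-U zero    = refl
count-U (suc n) = trans (cong (_+ 1) (count-U n)) (+-comm n 1)

count-∅ : ∀ n → count ∅? n ≡ 0
count-∅ zero    = refl
count-∅ (suc n) = trans (+-identityʳ _) (count-∅ n)

count-none : {P : Pred ℕ 0ℓ} (P? : Decidable P) →
             ∀ n → (∀ x → x < n → ¬ P x) → count P? n ≡ 0
count-none P? zero    _    = refl
count-none P? (suc n) none with P? n
... | yes Pn = contradiction Pn (none n ≤-refl)
... | no  _  = trans (+-identityʳ _) (count-none P? n (λ x x<n → none x (m<n⇒m<1+n x<n)))

-- A pointwise identity between sums of indicators lifts to counts; this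
-- single lemma yields inclusion–exclusion, complements and partitions.
count-pointwise : {P Q R S : Pred ℕ 0ℓ}
  (P? : Decidable P) (Q? : Decidable Q) (R? : Decidable R) (S? : Decidable S) →
  (∀ x → indicator (P? x) + indicator (Q? x) ≡ indicator (R? x) + indicator (S? x)) →
  ∀ n → count P? n + count Q? n ≡ count R? n + count S? n
count-pointwise P? Q? R? S? pt zero    = refl
count-pointwise P? Q? R? S? pt (suc n) = begin
  (count P? n + indicator (P? n)) + (count Q? n + indicator (Q? n))
    ≡⟨ interchange (count P? n) _ _ _ ⟩
  (count P? n + count Q? n) + (indicator (P? n) + indicator (Q? n))
    ≡⟨ cong₂ _+_ (count-pointwise P? Q? R? S? pt n) (pt n) ⟩
  (count R? n + count S? n) + (indicator (R? n) + indicator (S? n))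
    ≡⟨ interchange (count R? n) _ _ _ ⟩
  (count R? n + indicator (R? n)) + (count S? n + indicator (S? n)) ∎
  where open ≡-Reasoning

module _ {P Q : Pred ℕ 0ℓ} (P? : Decidable P) (Q? : Decidable Q) where

  count-∪-∩ : ∀ n → count (P? ∪? Q?) n + count (P? ∩? Q?) n ≡ count P? n + count Q? n
  count-∪-∩ = count-pointwise (P? ∪? Q?) (P? ∩? Q?) P? Q? pointwise
    where
    pointwise : ∀ x → indicator ((P? ∪? Q?) x) + indicator ((P? ∩? Q?) x)
                    ≡ indicator (P? x) + indicator (Q? x)
    pointwise x with P? x | Q? x
    ... | yes _ | yes _ = refl
    ... | yes _ | no  _ = refl
    ... | no  _ | yes _ = refl
    ... | no  _ | no  _ = refl

  count-∪ : ∀ n → count (P? ∪? Q?) n ≤ count P? n + count Q? n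
  count-∪ n = subst (count (P? ∪? Q?) n ≤_) (count-∪-∩ n) (m≤m+n _ _)

  count-split : ∀ n → count (P? ∩? Q?) n + count (P? ∩? ∁? Q?) n ≡ count P? n
  count-split n = trans (count-pointwise (P? ∩? Q?) (P? ∩? ∁? Q?) P? ∅? pointwise n)
                        (trans (cong (count P? n +_) (count-∅ n)) (+-identityʳ _))
    where
    pointwise : ∀ x → indicator ((P? ∩? Q?) x) + indicator ((P? ∩? ∁? Q?) x)
                    ≡ indicator (P? x) + indicator (∅? x)
    pointwise x with P? x | Q? x
    ... | yes _ | yes _ = refl
    ... | yes _ | no  _ = refl
    ... | no  _ | yes _ = refl
    ... | no  _ | no  _ = refl

count-∁ : {P : Pred ℕ 0ℓ} (P? : Decidable P) → ∀ n → count P? n + count (∁? P?) n ≡ n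
count-∁ P? n = begin
  count P? n + count (∁? P?) n  ≡⟨ count-pointwise P? (∁? P?) U? ∅? pointwise n ⟩
  count U? n + count ∅? n       ≡⟨ cong₂ _+_ (count-U n) (count-∅ n) ⟩
  n + 0                         ≡⟨ +-identityʳ n ⟩
  n                             ∎
  where
  open ≡-Reasoning
  pointwise : ∀ x → indicator (P? x) + indicator (∁? P? x) ≡ indicator (U? x) + indicator (∅? x)
  pointwise x with P? x
  ... | yes _ = refl
  ... | no  _ = refl

count-+ : {P : Pred ℕ 0ℓ} (P? : Decidable P) →
          ∀ a k → count P? (a + k) ≡ count P? a + count (λ x → P? (a + x)) k
count-+ P? a zero    = trans (cong (count P?) (+-identityʳ a)) (sym (+-identityʳ _))
count-+ P? a (suc k) = begin
  count P? (a + suc k)                                        ≡⟨ cong (count P?) (+-suc a k) ⟩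
  count P? (a + k) + indicator (P? (a + k))                   ≡⟨ cong (_+ indicator (P? (a + k))) (count-+ P? a k) ⟩
  (count P? a + count (λ x → P? (a + x)) k) + indicator (P? (a + k))
                                                              ≡⟨ +-assoc (count P? a) _ _ ⟩
  count P? a + count (λ x → P? (a + x)) (suc k)               ∎
  where open ≡-Reasoning

count-periodic : {P : Pred ℕ 0ℓ} (P? : Decidable P) (T : ℕ) →
                 (∀ x → P (T + x) → P x) → (∀ x → P x → P (T + x)) →
                 ∀ k → count P? (k * T) ≡ k * count P? T
count-periodic P? T back forth zero    = refl
count-periodic P? T back forth (suc k) = begin
  count P? (T + k * T)                             ≡⟨ count-+ P? T (k * T) ⟩
  count P? T + count (λ x → P? (T + x)) (k * T)    ≡⟨ cong (count P? T +_) shift ⟩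
  count P? T + count P? (k * T)                    ≡⟨ cong (count P? T +_) (count-periodic P? T back forth k) ⟩
  count P? T + k * count P? T                      ∎
  where
  open ≡-Reasoning
  shift : count (λ x → P? (T + x)) (k * T) ≡ count P? (k * T)
  shift = count-cong (λ x → P? (T + x)) P? (k * T) (λ _ → back _) (λ _ → forth _)

-- Among x < d·k, the multiples of d satisfying R correspond to the c < k
-- with R (d·c): each block [d·c, d·c + d) contains only the multiple d·c.
count-multiples : {R : Pred ℕ 0ℓ} (R? : Decidable R) (d : ℕ) → 0 < d →
                  ∀ k → count ((d ∣?_) ∩? R?) (d * k) ≡ count (λ c → R? (d * c)) k
count-multiples R? d@(suc d′) _ zero    = cong (count _) (*-zeroʳ d)
count-multiples {R} R? d@(suc d′) 0<d (suc k) = begin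
  count M? (d * suc k)                                   ≡⟨ cong (count M?) (trans (*-suc d k) (+-comm d (d * k))) ⟩
  count M? (d * k + d)                                   ≡⟨ count-+ M? (d * k) d ⟩
  count M? (d * k) + count (λ j → M? (d * k + j)) d      ≡⟨ cong₂ _+_ (count-multiples R? d 0<d k) block ⟩
  count (λ c → R? (d * c)) k + indicator (R? (d * k))    ∎
  where
  open ≡-Reasoning
  M? = (d ∣?_) ∩? R?
  block-start : indicator (M? (d * k + 0)) ≡ indicator (R? (d * k))
  block-start = ≤-antisym
    (indicator-mono (M? (d * k + 0)) (R? (d * k)) (λ (_ , r) → subst R (+-identityʳ (d * k)) r))
    (indicator-mono (R? (d * k)) (M? (d * k + 0))
      (λ r → subst (λ x → d ∣ x × R x) (sym (+-identityʳ (d * k))) (m∣m*n k , r)))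
  block-rest : count (λ j → M? (d * k + suc j)) d′ ≡ 0
  block-rest = count-none (λ j → M? (d * k + suc j)) d′ λ j j<d′ (d∣ , _) →
    <⇒≱ (s≤s j<d′) (∣⇒≤ (∣m+n∣m⇒∣n d∣ (m∣m*n k)))
  block : count (λ j → M? (d * k + j)) d ≡ indicator (R? (d * k))
  block = begin
    count (λ j → M? (d * k + j)) (1 + d′)                                   ≡⟨ count-+ (λ j → M? (d * k + j)) 1 d′ ⟩
    indicator (M? (d * k + 0)) + count (λ j → M? (d * k + suc j)) d′        ≡⟨ cong₂ _+_ block-start block-rest ⟩
    indicator (R? (d * k)) + 0                                              ≡⟨ +-identityʳ _ ⟩
    indicator (R? (d * k))                                                  ∎

count-∃ : ∀ {k} {D : Fin k → Pred ℕ 0ℓ} (D? : ∀ i → Decidable (D i)) →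
          ∀ n → count (λ x → Fin.any? (λ i → D? i x)) n ≤ sum (λ i → count (D? i) n)
count-∃ {zero}  D? n = ≤-reflexive (count-none _ n (λ { _ _ (() , _) }))
count-∃ {suc k} {D} D? n = begin
  count (λ x → Fin.any? (λ i → D? i x)) n
    ≤⟨ count-mono _ (D? zero ∪? Tail?) n (λ _ → split) ⟩
  count (D? zero ∪? Tail?) n
    ≤⟨ count-∪ (D? zero) Tail? n ⟩
  count (D? zero) n + count Tail? n
    ≤⟨ +-monoʳ-≤ (count (D? zero) n) (count-∃ (λ i → D? (suc i)) n) ⟩
  sum (λ i → count (D? i) n) ∎
  where
  open ≤-Reasoning
  Tail? : Decidable (λ x → ∃ λ i → D (suc i) x)
  Tail? x = Fin.any? (λ i → D? (suc i) x)
  split : ∀ {x} → (∃ λ i → D i x) → D zero x ⊎ (∃ λ i → D (suc i) x)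
  split (zero  , d) = inj₁ d
  split (suc i , d) = inj₂ (i , d)

count-∣ : ∀ d → 0 < d → ∀ k → count (d ∣?_) (d * k) ≡ k
count-∣ d 0<d k = begin
  count (d ∣?_) (d * k)          ≡⟨ count-cong (d ∣?_) ((d ∣?_) ∩? U?) (d * k) (λ _ d∣x → d∣x , _) (λ _ (d∣x , _) → d∣x) ⟩
  count ((d ∣?_) ∩? U?) (d * k)  ≡⟨ count-multiples U? d 0<d k ⟩
  count U? k                     ≡⟨ count-U k ⟩
  k                              ∎
  where open ≡-Reasoning

sum-mono : ∀ {k} (f g : Fin k → ℕ) → (∀ i → f i ≤ g i) → sum f ≤ sum g
sum-mono {zero}  f g f≤g = z≤n
sum-mono {suc k} f g f≤g = +-mono-≤ (f≤g zero) (sum-mono (λ i → f (suc i)) (λ i → g (suc i)) (λ i → f≤g (suc i)))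

sum-≤-* : ∀ {k} (f : Fin k → ℕ) B → (∀ i → f i ≤ B) → sum f ≤ k * B
sum-≤-* {zero}  f B f≤B = z≤n
sum-≤-* {suc k} f B f≤B = +-mono-≤ (f≤B zero) (sum-≤-* (λ i → f (suc i)) B (λ i → f≤B (suc i)))

prime>1 : ∀ {p} → Prime p → 1 < p
prime>1 (prime _) = nonTrivial⇒n>1 _

gcd-+ : ∀ M b → gcd (M + b) M ≡ gcd b M
gcd-+ M b = ∣-antisym
  (gcd-greatest (∣m+n∣m⇒∣n (gcd[m,n]∣m (M + b) M) (gcd[m,n]∣n (M + b) M)) (gcd[m,n]∣n (M + b) M))
  (gcd-greatest (∣m∣n⇒∣m+n (gcd[m,n]∣n b M) (gcd[m,n]∣m b M)) (gcd[m,n]∣n b M))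

coprime-* : ∀ {x a b} → Coprime x a → Coprime x b → Coprime x (a * b)
coprime-* {x} {a} x⊥a x⊥b (d∣x , d∣ab) = x⊥b (d∣x , coprime-divisor d⊥a d∣ab)
  where
  d⊥a : Coprime _ a
  d⊥a (e∣d , e∣a) = x⊥a (∣-trans e∣d d∣x , e∣a)

coprime-^ : ∀ {x a} k → Coprime x a → Coprime x (a ^ k)
coprime-^ zero    x⊥a (_ , d∣1) = ∣1⇒≡1 d∣1
coprime-^ (suc k) x⊥a = coprime-* x⊥a (coprime-^ k x⊥a)

coprime-∏ : ∀ {x k} (f : Fin k → ℕ) → (∀ i → Coprime x (f i)) → Coprime x (∏ f)
coprime-∏ {k = zero}  f _   (_ , d∣1) = ∣1⇒≡1 d∣1
coprime-∏ {k = suc k} f x⊥f = coprime-* (x⊥f zero) (coprime-∏ (λ i → f (suc i)) (λ i → x⊥f (suc i)))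

¬∣⇒coprime : ∀ {q x} → Prime q → ¬ q ∣ x → Coprime x q
¬∣⇒coprime q-prime q∤x (d∣x , d∣q) with prime⇒irreducible q-prime d∣q
... | inj₁ d≡1 = d≡1
... | inj₂ refl = contradiction d∣x q∤x

∣prime^⇒prime^ : ∀ {q} → Prime q → ∀ k x → x ∣ q ^ k → ∃ λ j → x ≡ q ^ j
∣prime^⇒prime^ q-prime zero    x x∣1 = 0 , ∣1⇒≡1 x∣1
∣prime^⇒prime^ {q} q-prime (suc k) x x∣q^k+1 with q ∣? x
... | yes (divides y refl) =
  let instance _ = prime⇒nonZero q-prime
      (j , y≡q^j) = ∣prime^⇒prime^ q-prime k y (*-cancelˡ-∣ q (subst (_∣ q ^ suc k) (*-comm y q) x∣q^k+1))
  in suc j , trans (cong (_* q) y≡q^j) (*-comm (q ^ j) q)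
... | no q∤x = ∣prime^⇒prime^ q-prime k x (coprime-divisor (¬∣⇒coprime q-prime q∤x) x∣q^k+1)

^-∣-^ : ∀ q {j k} → j ≤ k → q ^ j ∣ q ^ k
^-∣-^ q {j} {k} j≤k = divides (q ^ (k ∸ j)) (begin
  q ^ k              ≡⟨ cong (q ^_) (m+[n∸m]≡n j≤k) ⟨
  q ^ (j + (k ∸ j))  ≡⟨ ^-distribˡ-+-* q j (k ∸ j) ⟩
  q ^ j * q ^ (k ∸ j) ≡⟨ *-comm (q ^ j) _ ⟩
  q ^ (k ∸ j) * q ^ j ∎)
  where open ≡-Reasoning

prime^-divisors-chain : ∀ {q} → Prime q → ∀ k {x y} → x ∣ q ^ k → y ∣ q ^ k → x ∣ y ⊎ y ∣ x
prime^-divisors-chain {q} q-prime k x∣ y∣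
  with ∣prime^⇒prime^ q-prime k _ x∣ | ∣prime^⇒prime^ q-prime k _ y∣
... | i , refl | j , refl with ≤-total i j
...   | inj₁ i≤j = inj₁ (^-∣-^ q i≤j)
...   | inj₂ j≤i = inj₂ (^-∣-^ q j≤i)

∣∏ : ∀ {k} (f : Fin k → ℕ) i → f i ∣ ∏ f
∣∏ f zero    = m∣m*n _
∣∏ f (suc i) = ∣n⇒∣m*n (f zero) (∣∏ (λ j → f (suc j)) i)

∏-last : ∀ {k} (f : Fin (suc k) → ℕ) → ∏ f ≡ ∏ (λ i → f (inject₁ i)) * f (fromℕ k)
∏-last {zero}  f = trans (*-identityʳ (f zero)) (sym (+-identityʳ (f zero)))
∏-last {suc k} f = trans (cong (f zero *_) (∏-last (λ i → f (suc i)))) (sym (*-assoc (f zero) _ _))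

∏-pos : ∀ {k} (f : Fin k → ℕ) → (∀ i → 0 < f i) → 0 < ∏ f
∏-pos {zero}  f _     = s≤s z≤n
∏-pos {suc k} f f>0   = *-mono-≤ (f>0 zero) (∏-pos (λ i → f (suc i)) (λ i → f>0 (suc i)))

length-filter-upTo : {P : Pred ℕ 0ℓ} (P? : Decidable P) → ∀ n → length (filter P? (upTo n)) ≡ count P? n
length-filter-upTo P? zero    = refl
length-filter-upTo P? (suc n) = begin
  length (filter P? (upTo (suc n)))                       ≡⟨ cong (λ l → length (filter P? l)) (sym (upTo-∷ʳ n)) ⟩
  length (filter P? (upTo n ++ [ n ]))                    ≡⟨ cong length (filter-++ P? (upTo n) [ n ]) ⟩
  length (filter P? (upTo n) ++ filter P? [ n ])          ≡⟨ length-++ (filter P? (upTo n)) ⟩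
  length (filter P? (upTo n)) + length (filter P? [ n ])  ≡⟨ cong₂ _+_ (length-filter-upTo P? n) (last-step n) ⟩
  count P? n + indicator (P? n)                           ∎
  where
  open ≡-Reasoning
  last-step : ∀ x → length (filter P? [ x ]) ≡ indicator (P? x)
  last-step x with P? x
  ... | yes _ = refl
  ... | no  _ = refl

fold-min-glb : {A : Set} (f : A → ℕ) (z c : ℕ) (xs : List A) →
               c ≤ z → (∀ {x} → x ∈ xs → c ≤ f x) → c ≤ foldr (λ a m → f a ⊓ m) z xs
fold-min-glb f z c []       c≤z _     = c≤z
fold-min-glb f z c (x ∷ xs) c≤z lower = ⊓-glb (lower (here refl)) (fold-min-glb f z c xs c≤z (λ x∈ → lower (there x∈)))

fold-min-≤ : {A : Set} (f : A → ℕ) (z : ℕ) {x : A} {xs : List A} →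
             x ∈ xs → foldr (λ a m → f a ⊓ m) z xs ≤ f x
fold-min-≤ f z {xs = y ∷ _}  (here refl) = m⊓n≤m (f y) _
fold-min-≤ f z {xs = y ∷ _}  (there x∈)  = ≤-trans (m⊓n≤n (f y) _) (fold-min-≤ f z x∈)

δ-attained : ∀ N v → v < N → (∀ a → a < N → deg N v ≤ deg N a) → δ N ≡ deg N v
δ-attained N v v<N minimal = ≤-antisym
  (fold-min-≤ (deg N) (deg N 0) (∈-upTo⁺ v<N))
  (fold-min-glb (deg N) (deg N 0) (deg N v) (upTo N) (minimal 0 (≤-<-trans z≤n v<N))
     (λ a∈ → minimal _ (∈-upTo⁻ a∈)))

IsPow : ℕ → ℕ → ℕ → Set
IsPow N a b = Any (λ k → modN (k * a) N ≡ b) (upTo N)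

modN-% : ∀ x N .{{_ : NonZero N}} → modN x N ≡ x % N
modN-% x (suc _) = refl

modN-< : ∀ x N .{{_ : NonZero N}} → x < N → modN x N ≡ x
modN-< x N x<N = trans (modN-% x N) (m<n⇒m%n≡m x<N)

%-*-congˡ : ∀ N .{{_ : NonZero N}} {x y} c → x % N ≡ y % N → (x * c) % N ≡ (y * c) % N
%-*-congˡ N {x} {y} c x≡y = begin
  (x * c) % N                  ≡⟨ %-distribˡ-* x c N ⟩
  ((x % N) * (c % N)) % N      ≡⟨ cong (λ z → (z * (c % N)) % N) x≡y ⟩
  ((y % N) * (c % N)) % N      ≡⟨ %-distribˡ-* y c N ⟨
  (y * c) % N                  ∎
  where open ≡-Reasoning

gcd-multiple : ∀ N .{{_ : NonZero N}} a → ∃ λ k → (k * a) % N ≡ gcd a N % N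
gcd-multiple N@(suc n′) a with Bézout.identity (gcd-GCD a N)
... | Bézout.+- x y g+yN≡xa = x , (begin
  (x * a) % N           ≡⟨ cong (_% N) g+yN≡xa ⟨
  (gcd a N + y * N) % N ≡⟨ [m+kn]%n≡m%n (gcd a N) y N ⟩
  gcd a N % N           ∎)
  where open ≡-Reasoning
... | Bézout.-+ x y g+xa≡yN = n′ * x , (begin
  (n′ * x * a) % N                     ≡⟨ [m+kn]%n≡m%n (n′ * x * a) y N ⟨
  (n′ * x * a + y * N) % N             ≡⟨ cong (λ z → (n′ * x * a + z) % N) g+xa≡yN ⟨
  (n′ * x * a + (g + x * a)) % N       ≡⟨ cong (_% N) (rearrange n′ x a g) ⟩
  (g + (x * a) * N) % N                ≡⟨ [m+kn]%n≡m%n g (x * a) N ⟩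
  g % N                                ∎)
  where
  open ≡-Reasoning
  g = gcd a N
  rearrange : ∀ n′ x a g → n′ * x * a + (g + x * a) ≡ g + (x * a) * suc n′
  rearrange = solve-∀

power⇒gcd∣ : ∀ N .{{_ : NonZero N}} a b → IsPow N a b → gcd a N ∣ b
power⇒gcd∣ N a b pow with satisfied pow
... | k , k*a≡b = subst (gcd a N ∣_) (trans (sym (modN-% (k * a) N)) k*a≡b)
                    (%-presˡ-∣ (∣n⇒∣m*n k (gcd[m,n]∣m a N)) (gcd[m,n]∣n a N))

gcd∣⇒power : ∀ N .{{_ : NonZero N}} a b → b < N → gcd a N ∣ b → IsPow N a b
gcd∣⇒power N a b b<N (divides c b≡cg) with gcd-multiple N a
... | k , ka≡g = lose (∈-upTo⁺ (m%n<n (k * c) N)) (begin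
  modN ((k * c) % N * a) N   ≡⟨ modN-% _ N ⟩
  ((k * c) % N * a) % N      ≡⟨ %-*-congˡ N a (m%n%n≡m%n (k * c) N) ⟩
  (k * c * a) % N            ≡⟨ cong (_% N) (xy∙z≈xz∙y k c a) ⟩
  (k * a * c) % N            ≡⟨ %-*-congˡ N c ka≡g ⟩
  (g * c) % N                ≡⟨ cong (_% N) (trans (*-comm g c) (sym b≡cg)) ⟩
  b % N                      ≡⟨ m<n⇒m%n≡m b<N ⟩
  b                          ∎)
  where
  open ≡-Reasoning
  g = gcd a N

-- The closed neighbourhood of a vertex a with gcd(a, N) = g consists of the
-- b with g ∣ b (powers of a) or gcd(b, N) ∣ g (elements a is a power of).
InNbhd : ℕ → ℕ → ℕ → Set
InNbhd N g b = g ∣ b ⊎ gcd b N ∣ g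

InNbhd? : ∀ N g → Decidable (InNbhd N g)
InNbhd? N g b = (g ∣? b) ⊎-dec (gcd b N ∣? g)

count-≡ : ∀ a n → a < n → count (a ≟_) n ≡ 1
count-≡ a (suc n) a<1+n with a ≟ n
... | yes refl = cong (_+ 1) (count-none (a ≟_) a (λ b b<a a≡b → <⇒≢ b<a (sym a≡b)))
... | no  a≢n  = trans (+-identityʳ _) (count-≡ a n (≤∧≢⇒< (≤-pred a<1+n) a≢n))

deg-closed-nbhd : ∀ N .{{_ : NonZero N}} a → a < N → deg N a + 1 ≡ count (InNbhd? N (gcd a N)) N
deg-closed-nbhd N a a<N = begin
  deg N a + 1                                                 ≡⟨ cong₂ _+_ (length-filter-upTo (Adj? N a) N) (sym (count-≡ a N a<N)) ⟩
  count (Adj? N a) N + count (a ≟_) N                         ≡⟨ count-∪-∩ (Adj? N a) (a ≟_) N ⟨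
  count (Adj? N a ∪? (a ≟_)) N + count (Adj? N a ∩? (a ≟_)) N ≡⟨ cong₂ _+_ (count-cong _ (InNbhd? N g) N (λ _ → to) from) adjacent-distinct ⟩
  count (InNbhd? N g) N + 0                                   ≡⟨ +-identityʳ _ ⟩
  count (InNbhd? N g) N                                       ∎
  where
  open ≡-Reasoning
  g = gcd a N
  to : ∀ {b} → (¬ a ≡ b × (IsPow N a b ⊎ IsPow N b a)) ⊎ a ≡ b → InNbhd N g b
  to {b} (inj₁ (_ , inj₁ b∈⟨a⟩)) = inj₁ (power⇒gcd∣ N a b b∈⟨a⟩)
  to {b} (inj₁ (_ , inj₂ a∈⟨b⟩)) = inj₂ (gcd-greatest (power⇒gcd∣ N b a a∈⟨b⟩) (gcd[m,n]∣n b N))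
  to     (inj₂ refl)             = inj₁ (gcd[m,n]∣m a N)
  from : ∀ {b} → b < N → InNbhd N g b → (¬ a ≡ b × (IsPow N a b ⊎ IsPow N b a)) ⊎ a ≡ b
  from {b} b<N nb with a ≟ b | nb
  ... | yes a≡b | _       = inj₂ a≡b
  ... | no  a≢b | inj₁ g∣b = inj₁ (a≢b , inj₁ (gcd∣⇒power N a b b<N g∣b))
  ... | no  a≢b | inj₂ e∣g = inj₁ (a≢b , inj₂ (gcd∣⇒power N b a a<N (∣-trans e∣g (gcd[m,n]∣m a N))))
  adjacent-distinct : count (Adj? N a ∩? (a ≟_)) N ≡ 0
  adjacent-distinct = count-none _ N (λ _ _ ((a≢b , _) , a≡b) → a≢b a≡b)

totient : ℕ → ℕ
totient M = count (λ b → coprime? b M) M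

-- Coprimality to M is M-periodic, so [0, k·M) contains k·φ(M) units.
count-coprime : ∀ M k → count (λ b → coprime? b M) (k * M) ≡ k * totient M
count-coprime M = count-periodic (λ b → coprime? b M) M
  (λ b M+b⊥M (d∣b , d∣M) → M+b⊥M (∣m∣n⇒∣m+n d∣M d∣b , d∣M))
  (λ b → coprime-+)

gcd-unit-* : ∀ {c M} x → Coprime c M → gcd (c * x) M ≡ gcd x M
gcd-unit-* {c} {M} x c⊥M = ∣-antisym
  (gcd-greatest (coprime-divisor g⊥c (gcd[m,n]∣m (c * x) M)) (gcd[m,n]∣n (c * x) M))
  (gcd-greatest (∣n⇒∣m*n c (gcd[m,n]∣m x M)) (gcd[m,n]∣n x M))
  where
  g⊥c : Coprime (gcd (c * x) M) c
  g⊥c (e∣g , e∣c) = c⊥M (e∣c , ∣-trans e∣g (gcd[m,n]∣n (c * x) M))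

-- Neighbourhood of a unitary divisor: if N = v·M with v, M coprime, then
-- gcd(b, N) ∣ v exactly when b is coprime to M, so
-- |N[v]| = #(multiples of v) + #(units mod M) − #(both) = M + v·φ(M) − φ(M).
nbhd-unitary : ∀ {N} v M → N ≡ v * M → 0 < v → Coprime v M →
               count (InNbhd? N v) N + totient M ≡ M + v * totient M
nbhd-unitary v M refl 0<v v⊥M = begin
  count (InNbhd? N v) N + totient M                  ≡⟨ cong₂ _+_ (count-cong _ (∣v? ∪? Unit?) N (λ _ → to) (λ _ → from)) (sym both) ⟩
  count (∣v? ∪? Unit?) N + count (∣v? ∩? Unit?) N    ≡⟨ count-∪-∩ ∣v? Unit? N ⟩
  count ∣v? N + count Unit? N                        ≡⟨ cong₂ _+_ (count-∣ v 0<v M) (count-coprime M v) ⟩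
  M + v * totient M                                  ∎
  where
  open ≡-Reasoning
  N = v * M
  ∣v? = v ∣?_
  Unit? : Decidable (λ b → Coprime b M)
  Unit? b = coprime? b M
  to : ∀ {b} → InNbhd N v b → v ∣ b ⊎ Coprime b M
  to (inj₁ v∣b)  = inj₁ v∣b
  to {b} (inj₂ e∣v) = inj₂ λ (d∣b , d∣M) → v⊥M (∣-trans (gcd-greatest d∣b (∣n⇒∣m*n v d∣M)) e∣v , d∣M)
  from : ∀ {b} → v ∣ b ⊎ Coprime b M → InNbhd N v b
  from (inj₁ v∣b) = inj₁ v∣b
  from {b} (inj₂ b⊥M) = inj₂ (coprime-divisor e⊥M (subst (gcd b N ∣_) (*-comm v M) (gcd[m,n]∣n b N)))
    where
    e⊥M : Coprime (gcd b N) M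
    e⊥M (d∣e , d∣M) = b⊥M (∣-trans d∣e (gcd[m,n]∣m b N) , d∣M)
  -- multiples v·c with c < M, where v·c is a unit mod M iff c is
  both : count (∣v? ∩? Unit?) N ≡ totient M
  both = trans (count-multiples Unit? v 0<v M)
               (count-cong _ Unit? M (λ _ vc⊥M (d∣c , d∣M) → vc⊥M (∣n⇒∣m*n v d∣c , d∣M))
                                     (λ _ c⊥M → ⊥-sym (coprime-* (⊥-sym v⊥M) (⊥-sym c⊥M))))

-- If g divides the prime power q^A, every neighbour of q^A is a neighbour of g:
-- multiples of q^A are multiples of g, and a divisor of q^A is comparable with g.
nbhd-prime-power : ∀ {q} → Prime q → ∀ N A g → g ∣ q ^ A →
                   count (InNbhd? N (q ^ A)) N ≤ count (InNbhd? N g) N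
nbhd-prime-power {q} q-prime N A g g∣q^A = count-mono _ _ N (λ _ → neighbour)
  where
  neighbour : ∀ {b} → InNbhd N (q ^ A) b → InNbhd N g b
  neighbour (inj₁ q^A∣b) = inj₁ (∣-trans g∣q^A q^A∣b)
  neighbour {b} (inj₂ e∣q^A) with prime^-divisors-chain q-prime A e∣q^A g∣q^A
  ... | inj₁ e∣g = inj₂ e∣g
  ... | inj₂ g∣e = inj₁ (∣-trans g∣e (gcd[m,n]∣m b N))

κ : ℕ → ℕ → ℕ
κ M p = count (λ b → gcd b M ∣? p) M

-- For N = q^(1+A)·M with q a prime not dividing M, and p ∣ g:  every b with
-- gcd(b, M) ∣ p and q ∤ b is a neighbour of g, and there are exactly
-- (q^(1+A) − q^A)·κ(M, p) of them below N.
nbhd-lower-bound : ∀ {q} → Prime q → ∀ {N} M A {p g} → N ≡ q ^ suc A * M → Coprime q M → p ∣ g →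
                   q ^ suc A * κ M p ≤ count (InNbhd? N g) N + q ^ A * κ M p
nbhd-lower-bound {q} q-prime M A {p} {g} refl q⊥M p∣g = begin
  v * κ M p                                   ≡⟨ count-G (q * Q) ⟨
  count G? N                                  ≡⟨ count-split G? (q ∣?_) N ⟨
  count (G? ∩? (q ∣?_)) N + count Far? N      ≤⟨ +-mono-≤ (≤-reflexive divisible) far-are-neighbours ⟩
  Q * κ M p + count (InNbhd? N g) N           ≡⟨ +-comm (Q * κ M p) _ ⟩
  count (InNbhd? N g) N + Q * κ M p           ∎
  where
  open ≤-Reasoning
  Q = q ^ A
  v = q * Q
  N = v * M
  0<q : 0 < q
  0<q = ≤-<-trans z≤n (prime>1 q-prime)
  G? : Decidable (λ b → gcd b M ∣ p)
  G? b = gcd b M ∣? p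
  Far? = G? ∩? ∁? (q ∣?_)
  count-G : ∀ k → count G? (k * M) ≡ k * κ M p
  count-G = count-periodic G? M (λ b → subst (_∣ p) (gcd-+ M b)) (λ b → subst (_∣ p) (sym (gcd-+ M b)))
  -- The multiples of q are q·c with c < Q·M, and gcd(q·c, M) = gcd(c, M).
  divisible : count (G? ∩? (q ∣?_)) N ≡ Q * κ M p
  divisible = ≡.begin
    count (G? ∩? (q ∣?_)) N              ≡.≡⟨ count-cong _ ((q ∣?_) ∩? G?) N (λ _ (x , y) → y , x) (λ _ (x , y) → y , x) ⟩
    count ((q ∣?_) ∩? G?) N              ≡.≡⟨ cong (count ((q ∣?_) ∩? G?)) (*-assoc q Q M) ⟩
    count ((q ∣?_) ∩? G?) (q * (Q * M))  ≡.≡⟨ count-multiples G? q 0<q (Q * M) ⟩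
    count (λ c → G? (q * c)) (Q * M)     ≡.≡⟨ count-cong _ G? (Q * M) (λ _ → subst (_∣ p) (gcd-unit-* _ q⊥M)) (λ _ → subst (_∣ p) (sym (gcd-unit-* _ q⊥M))) ⟩
    count G? (Q * M)                     ≡.≡⟨ count-G Q ⟩
    Q * κ M p                            ≡.∎
  -- If gcd(b, M) ∣ p and q ∤ b, then gcd(b, N) is prime to q, hence divides M,
  -- hence divides gcd(b, M) ∣ p ∣ g.
  far-are-neighbours : count Far? N ≤ count (InNbhd? N g) N
  far-are-neighbours = count-mono Far? _ N (λ _ → neighbour)
    where
    neighbour : ∀ {b} → gcd b M ∣ p × ¬ q ∣ b → InNbhd N g b
    neighbour {b} (G∣p , q∤b) = inj₂ (∣-trans (gcd-greatest (gcd[m,n]∣m b N) e∣M) (∣-trans G∣p p∣g))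
      where
      e⊥q : Coprime (gcd b N) q
      e⊥q = ¬∣⇒coprime q-prime (λ q∣e → q∤b (∣-trans q∣e (gcd[m,n]∣m b N)))
      e∣M : gcd b N ∣ M
      e∣M = coprime-divisor (coprime-^ (suc A) e⊥q) (gcd[m,n]∣n b N)

-- With M = p·M′ and p > 1, the units mod M and the numbers p·c with c a unit
-- mod M′ are disjoint families inside the set counted by κ(M, p).
κ-lower-bound : ∀ {M} p M′ → M ≡ p * M′ → 1 < p → totient M + totient M′ ≤ κ M p
κ-lower-bound p M′ refl 1<p = begin
  totient M + totient M′                              ≤⟨ +-monoʳ-≤ (totient M) p·units ⟩
  totient M + count X? M                              ≡⟨ count-∪-∩ Unit? X? M ⟨
  count (Unit? ∪? X?) M + count (Unit? ∩? X?) M       ≡⟨ cong (count (Unit? ∪? X?) M +_) disjoint ⟩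
  count (Unit? ∪? X?) M + 0                           ≡⟨ +-identityʳ _ ⟩
  count (Unit? ∪? X?) M                               ≤⟨ count-mono _ G? M (λ _ → inside) ⟩
  κ M p                                               ∎
  where
  open ≤-Reasoning
  M = p * M′
  Unit? : Decidable (λ b → Coprime b M)
  Unit? b = coprime? b M
  G? : Decidable (λ b → gcd b M ∣ p)
  G? b = gcd b M ∣? p
  X? = (p ∣?_) ∩? G?
  -- gcd(p·c, p·M′) = p·gcd(c, M′) = p for c coprime to M′.
  p·units : totient M′ ≤ count X? M
  p·units = begin
    totient M′                         ≤⟨ count-mono _ (λ c → G? (p * c)) M′ (λ {c} _ c⊥M′ → ∣-reflexive (gcd-p c c⊥M′)) ⟩
    count (λ c → G? (p * c)) M′        ≡⟨ count-multiples G? p (<-trans z<1 1<p) M′ ⟨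
    count X? M                         ∎
    where
    z<1 : 0 < 1
    z<1 = s≤s z≤n
    gcd-p : ∀ c → Coprime c M′ → gcd (p * c) M ≡ p
    gcd-p c c⊥M′ = ≡.begin
      gcd (p * c) (p * M′) ≡.≡⟨ c*gcd[m,n]≡gcd[cm,cn] p c M′ ⟨
      p * gcd c M′         ≡.≡⟨ cong (p *_) (coprime⇒gcd≡1 c⊥M′) ⟩
      p * 1                ≡.≡⟨ *-identityʳ p ⟩
      p                    ≡.∎
  disjoint : count (Unit? ∩? X?) M ≡ 0
  disjoint = count-none _ M (λ _ _ (b⊥M , p∣b , _) → <⇒≢ 1<p (sym (b⊥M (p∣b , m∣m*n M′))))
  inside : ∀ {b} → Coprime b M ⊎ (p ∣ b × gcd b M ∣ p) → gcd b M ∣ p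
  inside {b} (inj₁ b⊥M)     = subst (_∣ p) (sym (coprime⇒gcd≡1 b⊥M)) (1∣ p)
  inside     (inj₂ (_ , G)) = G

-- A unit mod p·M′ is a unit mod M′, so φ(p·M′) ≤ p·φ(M′).
totient-* : ∀ {M} p M′ → M ≡ p * M′ → totient M ≤ p * totient M′
totient-* p M′ refl = begin
  totient (p * M′)                            ≤⟨ count-mono _ (λ b → coprime? b M′) (p * M′)
                                                   (λ _ b⊥M (d∣b , d∣M′) → b⊥M (d∣b , ∣n⇒∣m*n p d∣M′)) ⟩
  count (λ b → coprime? b M′) (p * M′)        ≡⟨ count-coprime M′ p ⟩
  p * totient M′                              ∎
  where open ≤-Reasoning

-- The numerical core of the comparison |N[v]| ≤ |N[g]|, with D = |N[v]|,
-- C = |N[g]|, v = q·Q, φ = φ(M), φ′ = φ(M/p): the hypotheses are the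
-- neighbourhood formula for v, the lower bound for g, the two totient bounds
-- for κ, and the growth conditions r·p < q, M ≤ r·φ.
degree-comparison : ∀ {r p q Q M φ φ′ κ D C} →
  D + φ ≡ M + q * Q * φ → q * Q * κ ≤ C + Q * κ →
  φ + φ′ ≤ κ → φ ≤ p * φ′ → r * p < q → M ≤ r * φ → 1 ≤ r → 1 ≤ Q → D ≤ C
degree-comparison {suc r′} {p} {suc s} {suc Q′} {M} {φ} {φ′} {κ} {D} {C}
                  nbhd-v lower κ-bound φ-bound (s≤s rp≤s) M≤rφ (s≤s _) (s≤s _) =
  +-cancelʳ-≤ φ D C (begin
    D + φ                                ≡⟨ nbhd-v ⟩
    M + suc s * Q * φ                    ≡⟨ split-q M s Q φ ⟩
    (M + Q * φ) + s * Q * φ              ≤⟨ +-monoˡ-≤ (s * Q * φ) slack ⟩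
    (φ + s * Q * φ′) + s * Q * φ         ≡⟨ regroup φ (s * Q) φ′ ⟩
    s * Q * (φ + φ′) + φ                 ≤⟨ +-monoˡ-≤ φ (*-monoʳ-≤ (s * Q) κ-bound) ⟩
    s * Q * κ + φ                        ≤⟨ +-monoˡ-≤ φ sQκ≤C ⟩
    C + φ                                ∎)
  where
  open ≤-Reasoning
  Q = suc Q′
  r = suc r′
  split-q : ∀ M s Q φ → M + suc s * Q * φ ≡ (M + Q * φ) + s * Q * φ
  split-q = solve-∀
  regroup : ∀ φ x φ′ → (φ + x * φ′) + x * φ ≡ x * (φ + φ′) + φ
  regroup = solve-∀
  -- (r + Q)·φ ≤ (1 + r·Q)·φ because (r − 1)(Q − 1) ≥ 0; then φ ≤ p·φ′ and r·p ≤ s.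
  slack : M + Q * φ ≤ φ + s * Q * φ′
  slack = begin
    M + Q * φ                              ≤⟨ +-monoˡ-≤ (Q * φ) M≤rφ ⟩
    r * φ + Q * φ                          ≤⟨ m≤m+n (r * φ + Q * φ) (r′ * Q′ * φ) ⟩
    r * φ + Q * φ + r′ * Q′ * φ            ≡⟨ product-slack r′ Q′ φ ⟩
    φ + (r * Q) * φ                        ≤⟨ +-monoʳ-≤ φ (*-monoʳ-≤ (r * Q) φ-bound) ⟩
    φ + (r * Q) * (p * φ′)                 ≡⟨ cong (φ +_) (swap-factors r Q p φ′) ⟩
    φ + (r * p) * (Q * φ′)                 ≤⟨ +-monoʳ-≤ φ (*-monoˡ-≤ (Q * φ′) rp≤s) ⟩
    φ + s * (Q * φ′)                       ≡⟨ cong (φ +_) (sym (*-assoc s Q φ′)) ⟩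
    φ + s * Q * φ′                         ∎
    where
    product-slack : ∀ r′ Q′ φ → suc r′ * φ + suc Q′ * φ + r′ * Q′ * φ ≡ φ + (suc r′ * suc Q′) * φ
    product-slack = solve-∀
    swap-factors : ∀ r Q p φ′ → (r * Q) * (p * φ′) ≡ (r * p) * (Q * φ′)
    swap-factors = solve-∀
  -- q·Q·κ = Q·κ + s·Q·κ, so the lower bound for C leaves s·Q·κ ≤ C.
  sQκ≤C : s * Q * κ ≤ C
  sQκ≤C = +-cancelʳ-≤ (Q * κ) (s * Q * κ) C (begin
    s * Q * κ + Q * κ   ≡⟨ split-Q s Q κ ⟩
    suc s * Q * κ       ≤⟨ lower ⟩
    C + Q * κ           ∎)
    where
    split-Q : ∀ s Q κ → s * Q * κ + Q * κ ≡ suc s * Q * κ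
    split-Q = solve-∀

-- We write n = M · q^A with q = p_r, A = α_r and
-- M = p₁^α₁ ⋯ p_{r−1}^α_{r−1}, and p′ i = p_{i+1} for the primes of M.
module Factorisation (m : ℕ) (p α : Fin (2 + m) → ℕ)
  (p-prime : ∀ i → Prime (p i)) (α≥1 : ∀ i → 1 ≤ α i) (p-increasing : ∀ i j → i <ᶠ j → p i < p j) where

  r : ℕ
  r = 2 + m

  p′ : Fin (1 + m) → ℕ
  p′ i = p (inject₁ i)

  q A : ℕ
  q = p (fromℕ (1 + m))
  A = α (fromℕ (1 + m))

  M : ℕ
  M = ∏ (λ i → p′ i ^ α (inject₁ i))

  n≡M*q^A : ∏ (λ i → p i ^ α i) ≡ M * q ^ A
  n≡M*q^A = ∏-last (λ i → p i ^ α i)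

  p′<q : ∀ i → p′ i < q
  p′<q i = p-increasing (inject₁ i) (fromℕ (1 + m))
    (subst₂ _<_ (sym (toℕ-inject₁ i)) (sym (toℕ-fromℕ (suc m))) (toℕ<n i))

  -- q is a prime larger than every prime of M, hence coprime to M.
  q⊥M : Coprime q M
  q⊥M = coprime-∏ _ (λ i → coprime-^ (α (inject₁ i)) (¬∣⇒coprime (p-prime (inject₁ i)) (p′∤q i)))
    where
    p′∤q : ∀ i → ¬ p′ i ∣ q
    p′∤q i p′∣q with prime⇒irreducible (p-prime (fromℕ (1 + m))) p′∣q
    ... | inj₁ p′≡1 = <⇒≢ (prime>1 (p-prime (inject₁ i))) (sym p′≡1)
    ... | inj₂ p′≡q = <⇒≢ (p′<q i) p′≡q

  coprime-to-M : ∀ x → (∀ i → ¬ p′ i ∣ x) → Coprime x M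
  coprime-to-M x p′∤x = coprime-∏ _ (λ i → coprime-^ (α (inject₁ i)) (¬∣⇒coprime (p-prime (inject₁ i)) (p′∤x i)))

  p′∣M : ∀ i → p′ i ∣ M
  p′∣M i = ∣-trans (divides-power (α≥1 (inject₁ i))) (∣∏ (λ j → p′ j ^ α (inject₁ j)) i)
    where
    divides-power : ∀ {k} → 1 ≤ k → p′ i ∣ p′ i ^ k
    divides-power {suc k} _ = m∣m*n _

  cofactor : Fin (1 + m) → ℕ
  cofactor i = quotient (p′∣M i)

  M≡p′*cofactor : ∀ i → M ≡ p′ i * cofactor i
  M≡p′*cofactor i = m∣n⇒n≡m*quotient (p′∣M i)

  p-monotone : ∀ i j → toℕ i ≤ toℕ j → p i ≤ p j
  p-monotone i j i≤j with toℕ i ≟ toℕ j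
  ... | yes i≡j = ≤-reflexive (cong p (toℕ-injective i≡j))
  ... | no  i≢j = <⇒≤ (p-increasing i j (≤∧≢⇒< i≤j i≢j))

  Hypothesis : Set
  Hypothesis = ((2 + m) + 1 ≤ p zero × (2 + m) * p (inject₁ (fromℕ m)) < p (fromℕ (1 + m)))
             ⊎ (∀ (i : Fin (1 + m)) → (2 + m) * p (inject₁ i) < p (suc i))

  -- Either hypothesis gives r·p_{r−1} < p_r, hence r·p_i < q for all primes p_i of M.
  r*p′<q : Hypothesis → ∀ i → r * p′ i < q
  r*p′<q hyp i = ≤-<-trans (*-monoʳ-≤ r p′≤penultimate) (last-gap hyp)
    where
    last-gap : Hypothesis → r * p′ (fromℕ m) < q
    last-gap (inj₁ (_ , gap)) = gap
    last-gap (inj₂ gaps)      = gaps (fromℕ m)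
    p′≤penultimate : p′ i ≤ p′ (fromℕ m)
    p′≤penultimate = p-monotone _ _ (subst₂ _≤_ (sym (toℕ-inject₁ i))
                   (trans (sym (toℕ-fromℕ m)) (sym (toℕ-inject₁ (fromℕ m)))) (≤-pred (toℕ<n i)))

  c*cofactor≤M : ∀ c i → c ≤ p′ i → c * cofactor i ≤ M
  c*cofactor≤M c i c≤p′ = ≤-trans (*-monoˡ-≤ (cofactor i) c≤p′) (≤-reflexive (sym (M≡p′*cofactor i)))

  -- Union bound: a non-unit mod M is divisible by some p_i, so there are at
  -- most Σ M/p_i of them.
  non-units : count (∁? (λ b → coprime? b M)) M ≤ sum cofactor
  non-units = begin
    count (∁? (λ b → coprime? b M)) M            ≤⟨ count-mono _ Div? M (λ _ → some-prime-divides) ⟩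
    count Div? M                                 ≤⟨ count-∃ (λ i → p′ i ∣?_) M ⟩
    sum (λ i → count (p′ i ∣?_) M)               ≤⟨ sum-mono _ _ (λ i → ≤-reflexive (multiples i)) ⟩
    sum cofactor                                 ∎
    where
    open ≤-Reasoning
    Div? = λ b → Fin.any? (λ i → p′ i ∣? b)
    some-prime-divides : ∀ {b} → ¬ Coprime b M → ∃ λ i → p′ i ∣ b
    some-prime-divides {b} b⊥̸M with Div? b
    ... | yes divisor = divisor
    ... | no  none    = ⊥-elim (b⊥̸M (coprime-to-M b (λ i p′∣b → none (i , p′∣b))))
    multiples : ∀ i → count (p′ i ∣?_) M ≡ cofactor i
    multiples i = trans (cong (count (p′ i ∣?_)) (M≡p′*cofactor i))
                        (count-∣ (p′ i) (<-trans (s≤s z≤n) (prime>1 (p-prime (inject₁ i)))) (cofactor i))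

  cofactor-sum : Hypothesis → r * sum cofactor ≤ (1 + m) * M
  cofactor-sum (inj₁ (r+1≤p₁ , _)) = begin
    r * sum cofactor                        ≤⟨ *-monoˡ-≤ (sum cofactor) (n≤1+n r) ⟩
    (1 + r) * sum cofactor                  ≡⟨ *-distribˡ-sum (1 + r) cofactor ⟩
    sum (λ i → (1 + r) * cofactor i)        ≤⟨ sum-≤-* _ M (λ i → c*cofactor≤M (1 + r) i (large i)) ⟩
    (1 + m) * M                             ∎
    where
    open ≤-Reasoning
    -- every p_i is at least p₁ ≥ r + 1
    large : ∀ i → 1 + r ≤ p′ i
    large i = subst (_≤ p′ i) (+-comm r 1) (≤-trans r+1≤p₁ (p-monotone zero (inject₁ i) z≤n))
  cofactor-sum (inj₂ gaps) = *-cancelˡ-≤ 2 (begin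
    2 * (r * (cofactor zero + S))           ≡⟨ expand r (cofactor zero) S ⟩
    r * (2 * cofactor zero) + 2 * (r * S)   ≤⟨ +-mono-≤ (*-monoʳ-≤ r (c*cofactor≤M 2 zero (prime>1 (p-prime zero))))
                                                        (*-monoʳ-≤ 2 shifted) ⟩
    r * M + 2 * T                           ≡⟨ cong (r * M +_) (*-distribˡ-sum 2 (λ j → cofactor (inject₁ j))) ⟩
    r * M + sum (λ j → 2 * cofactor (inject₁ j))
                                            ≤⟨ +-monoʳ-≤ (r * M) (sum-≤-* _ M (λ j → c*cofactor≤M 2 (inject₁ j) (prime>1 (p-prime _)))) ⟩
    r * M + m * M                           ≡⟨ collect m M ⟩
    2 * ((1 + m) * M)                       ∎)
    where
    open ≤-Reasoning
    S = sum (λ j → cofactor (suc j))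
    T = sum (λ j → cofactor (inject₁ j))
    expand : ∀ r c S → 2 * (r * (c + S)) ≡ r * (2 * c) + 2 * (r * S)
    expand = solve-∀
    collect : ∀ m M → (2 + m) * M + m * M ≡ 2 * ((1 + m) * M)
    collect = solve-∀
    -- p_{j+1} > r·p_j gives r·(M/p_{j+1}) ≤ M/p_j.
    step : ∀ j → r * cofactor (suc j) ≤ cofactor (inject₁ j)
    step j = let instance _ = prime⇒nonZero (p-prime (inject₁ (inject₁ j))) in
      *-cancelˡ-≤ (p′ (inject₁ j)) (begin
        p′ (inject₁ j) * (r * cofactor (suc j))   ≡⟨ rotate (p′ (inject₁ j)) r (cofactor (suc j)) ⟩
        (r * p′ (inject₁ j)) * cofactor (suc j)   ≤⟨ *-monoˡ-≤ (cofactor (suc j)) (<⇒≤ (gaps (inject₁ j))) ⟩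
        p′ (suc j) * cofactor (suc j)             ≡⟨ trans (sym (M≡p′*cofactor (suc j))) (M≡p′*cofactor (inject₁ j)) ⟩
        p′ (inject₁ j) * cofactor (inject₁ j)     ∎)
      where
      rotate : ∀ x y z → x * (y * z) ≡ (y * x) * z
      rotate = solve-∀
    shifted : r * S ≤ T
    shifted = ≤-trans (≤-reflexive (*-distribˡ-sum r (λ j → cofactor (suc j)))) (sum-mono _ _ step)

  totient-bound : Hypothesis → M ≤ r * totient M
  totient-bound hyp = +-cancelʳ-≤ ((1 + m) * M) M (r * totient M) (begin
    M + (1 + m) * M                                  ≡⟨ cong (r *_) (count-∁ (λ b → coprime? b M) M) ⟨
    r * (totient M + count NonUnit? M)               ≡⟨ *-distribˡ-+ r (totient M) _ ⟩
    r * totient M + r * count NonUnit? M             ≤⟨ +-monoʳ-≤ (r * totient M) (≤-trans (*-monoʳ-≤ r non-units) (cofactor-sum hyp)) ⟩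
    r * totient M + (1 + m) * M                      ∎)
    where
    open ≤-Reasoning
    NonUnit? = ∁? (λ b → coprime? b M)

  A′ Q v : ℕ
  A′ = A ∸ 1
  Q = q ^ A′
  v = q ^ suc A′

  q^A≡v : q ^ A ≡ v
  q^A≡v = cong (q ^_) (sym (m+[n∸m]≡n (α≥1 (fromℕ (1 + m)))))

  q>0 : 0 < q
  q>0 = <-trans (s≤s z≤n) (prime>1 (p-prime (fromℕ (1 + m))))

  Q>0 : 0 < Q
  Q>0 = m^n>0 q {{>-nonZero q>0}} A′

  v>0 : 0 < v
  v>0 = *-mono-≤ q>0 Q>0

  module Minimum (N : ℕ) (N≡M*v : N ≡ M * v) (hyp : Hypothesis) where

    N≡v*M : N ≡ v * M
    N≡v*M = trans N≡M*v (*-comm M v)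

    v<N : v < N
    v<N = begin-strict
      v       <⟨ m<m+n v v>0 ⟩
      v + v   ≡⟨ cong (v +_) (+-identityʳ v) ⟨
      2 * v   ≤⟨ *-monoˡ-≤ v M≥2 ⟩
      M * v   ≡⟨ N≡M*v ⟨
      N       ∎
      where
      open ≤-Reasoning
      M≥2 : 2 ≤ M
      M≥2 = ≤-trans (prime>1 (p-prime zero))
              (∣⇒≤ {{>-nonZero (∏-pos _ (λ i → m^n>0 (p′ i) {{prime⇒nonZero (p-prime (inject₁ i))}} (α (inject₁ i))))}} (p′∣M zero))

    instance
      N≢0 : NonZero N
      N≢0 = >-nonZero (≤-<-trans z≤n v<N)

    -- C g is the size of the closed neighbourhood of any a with gcd(a, N) = g.
    C : ℕ → ℕ
    C g = count (InNbhd? N g) N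

    compare-divisible : ∀ g i → p′ i ∣ g → C v ≤ C g
    compare-divisible g i p′∣g = degree-comparison {r} {p′ i} {q} {Q} {M} {totient M} {totient (cofactor i)} {κ M (p′ i)}
      (nbhd-unitary v M N≡v*M v>0 (⊥-sym (coprime-^ (suc A′) (⊥-sym q⊥M))))
      (nbhd-lower-bound (p-prime (fromℕ (1 + m))) M A′ N≡v*M q⊥M p′∣g)
      (κ-lower-bound (p′ i) (cofactor i) (M≡p′*cofactor i) (prime>1 (p-prime (inject₁ i))))
      (totient-* (p′ i) (cofactor i) (M≡p′*cofactor i))
      (r*p′<q hyp i) (totient-bound hyp) (s≤s z≤n) Q>0

    -- Otherwise g is coprime to M, so it divides the prime power v.
    compare-coprime : ∀ g → g ∣ N → (∀ i → ¬ p′ i ∣ g) → C v ≤ C g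
    compare-coprime g g∣N p′∤g = nbhd-prime-power (p-prime (fromℕ (1 + m))) N (suc A′) g
      (coprime-divisor (coprime-to-M g p′∤g) (subst (g ∣_) N≡M*v g∣N))

    v-minimal : ∀ a → a < N → deg N v ≤ deg N a
    v-minimal a a<N = +-cancelʳ-≤ 1 (deg N v) (deg N a) (begin
      deg N v + 1    ≡⟨ deg-closed-nbhd N v v<N ⟩
      C (gcd v N)    ≡⟨ cong C (∣-antisym (gcd[m,n]∣m v N) (gcd-greatest ∣-refl v∣N)) ⟩
      C v            ≤⟨ compare (Fin.any? (λ i → p′ i ∣? g)) ⟩
      C g            ≡⟨ deg-closed-nbhd N a a<N ⟨
      deg N a + 1    ∎)
      where
      open ≤-Reasoning
      g = gcd a N
      v∣N : v ∣ N
      v∣N = subst (v ∣_) (sym N≡v*M) (m∣m*n M)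
      compare : Dec (∃ λ i → p′ i ∣ g) → C v ≤ C g
      compare (yes (i , p′∣g)) = compare-divisible g i p′∣g
      compare (no  none)       = compare-coprime g (gcd[m,n]∣n a N) (λ i p′∣g → none (i , p′∣g))

corollary1p4 : (m : ℕ) (p α : Fin (2 + m) → ℕ) (n : ℕ)
    → (∀ i → Prime (p i))
    → (∀ i → 1 ≤ α i)
    → (∀ i j → i <ᶠ j → p i < p j)
    → n ≡ ∏ (λ i → p i ^ α i)
    → ((2 + m) + 1 ≤ p zero × (2 + m) * p (inject₁ (fromℕ m)) < p (fromℕ (1 + m)))
      ⊎ (∀ (i : Fin (1 + m)) → (2 + m) * p (inject₁ i) < p (suc i))
    → δ n ≡ deg n (modN (p (fromℕ (1 + m)) ^ α (fromℕ (1 + m))) n)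
corollary1p4 m p α n p-prime α≥1 p-increasing n≡∏ hyp = begin
  δ n                       ≡⟨ δ-attained n v v<N v-minimal ⟩
  deg n v                   ≡⟨ cong (deg n) (modN-< v n v<N) ⟨
  deg n (modN v n)          ≡⟨ cong (λ x → deg n (modN x n)) q^A≡v ⟨
  deg n (modN (q ^ A) n)    ∎
  where
  open ≡-Reasoning
  open Factorisation m p α p-prime α≥1 p-increasing
  n≡M*v : n ≡ M * v
  n≡M*v = trans n≡∏ (trans n≡M*q^A (cong (M *_) q^A≡v))
  open Minimum n n≡M*v hyp
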